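{- Let $M$ be a quasi-permutation matrix. The permutations that contain $M$ as a submatrix and are minimal (for the pattern order on permutations) with this property are exactly those whose permutation matrices are obtained from $M$ by inserting rows (resp. columns) each containing exactly one entry $1$, this entry falling into a column (resp. row) of $M$ consisting only of $0$ entries. In particular, if $M$ has $k$ rows, $y$ of which are zero rows, and $\ell$ columns, $x$ of which are zero columns, then these minimal permutations have size $k+x=\ell+y$.
   Context: A quasi-permutation matrix is a binary matrix with at most one entry $1$ in each row and each column. A permutation $\sigma$ is identified with its permutation matrix $M_\sigma$ ($M_\sigma(i,j)=1$ iff $i=\sigma(j)$). A matrix $M'$ is a submatrix of $M$ if it is obtained by deleting some rows and/or columns; the pattern order on permutations is the submatrix order restricted to permutation matrices (classical pattern containment). -}

module Defs where

open import Data.Nat using (ℕ; zero; suc; _+_)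
open import Data.Bool using (Bool; true; false; if_then_else_)
open import Data.Fin using (Fin; _<_; _≟_) renaming (zero to fzero; suc to fsuc)
open import Data.Fin.Permutation using (Permutation′; _⟨$⟩ʳ_)
open import Data.Product using (Σ; ∃; _×_; _,_)
open import Relation.Binary.PropositionalEquality using (_≡_)
open import Relation.Nullary using (¬_)
open import Relation.Nullary.Decidable using (⌊_⌋)

Matrix : ℕ → ℕ → Set
Matrix k ℓ = Fin k → Fin ℓ → Bool

QuasiPermutation : ∀ {k ℓ} → Matrix k ℓ → Set
QuasiPermutation M =
  (∀ i j j′ → M i j ≡ true → M i j′ ≡ true → j ≡ j′) ×
  (∀ i i′ j → M i j ≡ true → M i′ j ≡ true → i ≡ i′)

StrictlyIncreasing : ∀ {m n} → (Fin m → Fin n) → Set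
StrictlyIncreasing f = ∀ {a b} → a < b → f a < f b

Submatrix : ∀ {k′ ℓ′ k ℓ} → Matrix k′ ℓ′ → Matrix k ℓ → Set
Submatrix {k′} {ℓ′} {k} {ℓ} M′ M =
  Σ (Fin k′ → Fin k) λ r → Σ (Fin ℓ′ → Fin ℓ) λ c →
    StrictlyIncreasing r × StrictlyIncreasing c × (∀ i j → M′ i j ≡ M (r i) (c j))

permMatrix : ∀ {n} → Permutation′ n → Matrix n n
permMatrix σ i j = ⌊ i ≟ σ ⟨$⟩ʳ j ⌋

_≼_ : ∀ {m n} → Permutation′ m → Permutation′ n → Set
τ ≼ σ = Submatrix (permMatrix τ) (permMatrix σ)

Contains : ∀ {k ℓ n} → Permutation′ n → Matrix k ℓ → Set
Contains σ M = Submatrix M (permMatrix σ)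

MinimalContaining : ∀ {k ℓ n} → Matrix k ℓ → Permutation′ n → Set
MinimalContaining M σ =
  Contains σ M × (∀ m (τ : Permutation′ m) → Contains τ M → τ ≼ σ → σ ≼ τ)

ZeroRow : ∀ {k ℓ} → Matrix k ℓ → Fin k → Set
ZeroRow M i = ∀ j → M i j ≡ false

ZeroCol : ∀ {k ℓ} → Matrix k ℓ → Fin ℓ → Set
ZeroCol M j = ∀ i → M i j ≡ false

-- N is obtained from M by inserting rows (resp. columns), each containing exactly
-- one entry 1, this entry falling into a zero column (resp. zero row) of M.
-- r, c record the positions of the original rows / columns of M inside N;
-- every other row / column of N is an inserted one.
ObtainedByInsertion : ∀ {k ℓ n m} → Matrix k ℓ → Matrix n m → Set
ObtainedByInsertion {k} {ℓ} {n} {m} M N =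
  Σ (Fin k → Fin n) λ r → Σ (Fin ℓ → Fin m) λ c →
    StrictlyIncreasing r × StrictlyIncreasing c × (∀ i j → M i j ≡ N (r i) (c j)) ×
    (∀ a → (∀ i → ¬ (r i ≡ a)) →
       Σ (Fin ℓ) λ j → N a (c j) ≡ true × ZeroCol M j ×
         (∀ b → N a b ≡ true → b ≡ c j)) ×
    (∀ b → (∀ j → ¬ (c j ≡ b)) →
       Σ (Fin k) λ i → N (r i) b ≡ true × ZeroRow M i ×
         (∀ a → N a b ≡ true → a ≡ r i))

count : ∀ {n} → (Fin n → Bool) → ℕ
count {zero} p = 0
count {suc n} p = (if p fzero then 1 else 0) + count (λ i → p (fsuc i))

isZeroRow : ∀ {k ℓ} → Matrix k ℓ → Fin k → Bool
isZeroRow M i = allFinFalse (M i)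
  where
  allFinFalse : ∀ {p} → (Fin p → Bool) → Bool
  allFinFalse {zero} f = true
  allFinFalse {suc p} f = if f fzero then false else allFinFalse (λ x → f (fsuc x))

isZeroCol : ∀ {k ℓ} → Matrix k ℓ → Fin ℓ → Bool
isZeroCol M j = isZeroRow (λ j′ i → M i j′) j

numZeroRows : ∀ {k ℓ} → Matrix k ℓ → ℕ
numZeroRows M = count (isZeroRow M)

numZeroCols : ∀ {k ℓ} → Matrix k ℓ → ℕ
numZeroCols M = count (isZeroCol M)

module Submission where

-- Fix an embedding of M into a permutation σ, i.e. increasing row and
-- column selections r, c.  Every row a of σ outside r carries its 1 in
-- column b = σ⁻¹(a).  If b lies in c, the corresponding column of M is a
-- zero column (a nonzero entry would put the 1 of column b in a row of r).
-- If b lies outside c as well, deleting row a and column b from σ gives a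
-- smaller pattern still containing M, so σ is not minimal.  Symmetrically
-- for columns; this proves "minimal ⇒ obtained by insertion".
--
-- For the sizes, the rows of r and the rows holding the 1 of the zero
-- columns of M are pairwise distinct in every permutation containing M,
-- so such a permutation has at least k + x rows; for a permutation obtained
-- by insertion these are all its rows, so it has exactly k + x rows, and by
-- transposition exactly ℓ + y columns.  Finally, if σ is obtained by
-- insertion and τ ≼ σ contains M, then τ has at least as many rows as σ,
-- and a submatrix of the same size is the whole matrix, so σ ≼ τ.

open import Defs
open import Data.Nat using (ℕ; _+_; zero; suc; _∸_; z≤n; s≤s)
import Data.Nat as ℕ
import Data.Nat.Properties as ℕP
open import Data.Fin using (Fin; toℕ; fromℕ<; inject₁; punchIn; punchOut; splitAt; join; _≟_)
  renaming (zero to fzero; suc to fsuc)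
import Data.Fin.Properties as FinP
open import Data.Fin.Permutation
  using (Permutation′; _⟨$⟩ʳ_; _⟨$⟩ˡ_; inverseˡ; inverseʳ; remove; flip; punchIn-permute)
open import Data.Bool using (Bool; true; false; if_then_else_)
open import Data.Bool.Properties using (T-≡; ¬-not)
open import Data.Product using (Σ; ∃; _×_; _,_; proj₁; proj₂)
open import Data.Sum using (_⊎_; inj₁; inj₂; [_,_]′)
open import Data.Empty using (⊥; ⊥-elim)
open import Function.Base using (_∘_)
open import Function.Bundles using (_⇔_; Equivalence; mk⇔)
open import Relation.Binary.Definitions using (tri<; tri≈; tri>)
open import Relation.Binary.PropositionalEquality
  using (_≡_; _≢_; refl; sym; trans; cong; cong₂; subst; subst₂; module ≡-Reasoning)
open import Relation.Nullary using (¬_; Dec; yes; no)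
open import Relation.Nullary.Decidable
  using (⌊_⌋; toWitness; fromWitness; isYes≗does; does-⇔)

true≢false : true ≢ false
true≢false ()

⌊⌋-⇔ : ∀ {A B : Set} → A ⇔ B → (a? : Dec A) (b? : Dec B) → ⌊ a? ⌋ ≡ ⌊ b? ⌋
⌊⌋-⇔ A⇔B a? b? = trans (isYes≗does a?) (trans (does-⇔ A⇔B a? b?) (sym (isYes≗does b?)))

entry⇒image : ∀ {n} (σ : Permutation′ n) {a b} → permMatrix σ a b ≡ true → a ≡ σ ⟨$⟩ʳ b
entry⇒image σ e = toWitness (Equivalence.from T-≡ e)

image⇒entry : ∀ {n} (σ : Permutation′ n) {a b} → a ≡ σ ⟨$⟩ʳ b → permMatrix σ a b ≡ true
image⇒entry σ e = Equivalence.to T-≡ (fromWitness e)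

σ-injective : ∀ {n} (σ : Permutation′ n) {x y} → σ ⟨$⟩ʳ x ≡ σ ⟨$⟩ʳ y → x ≡ y
σ-injective σ e = trans (sym (inverseˡ σ)) (trans (cong (σ ⟨$⟩ˡ_) e) (inverseˡ σ))

permMatrix-flip : ∀ {n} (σ : Permutation′ n) a b → permMatrix (flip σ) b a ≡ permMatrix σ a b
permMatrix-flip σ a b = ⌊⌋-⇔ (mk⇔ to from) (b ≟ σ ⟨$⟩ˡ a) (a ≟ σ ⟨$⟩ʳ b)
  where
  to : b ≡ σ ⟨$⟩ˡ a → a ≡ σ ⟨$⟩ʳ b
  to e = trans (sym (inverseʳ σ)) (cong (σ ⟨$⟩ʳ_) (sym e))
  from : a ≡ σ ⟨$⟩ʳ b → b ≡ σ ⟨$⟩ˡ a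
  from e = trans (sym (inverseˡ σ)) (cong (σ ⟨$⟩ˡ_) (sym e))

permMatrix-remove : ∀ {n} (σ : Permutation′ (suc n)) b i j →
  permMatrix (remove b σ) i j ≡ permMatrix σ (punchIn (σ ⟨$⟩ʳ b) i) (punchIn b j)
permMatrix-remove {n} σ b i j = ⌊⌋-⇔ (mk⇔ to from) (i ≟ τ ⟨$⟩ʳ j) (punchIn a i ≟ σ ⟨$⟩ʳ punchIn b j)
  where
  a : Fin (suc n)
  a = σ ⟨$⟩ʳ b
  τ : Permutation′ n
  τ = remove b σ
  to : i ≡ τ ⟨$⟩ʳ j → punchIn a i ≡ σ ⟨$⟩ʳ punchIn b j
  to e = trans (cong (punchIn a) e) (sym (punchIn-permute σ b j))
  from : punchIn a i ≡ σ ⟨$⟩ʳ punchIn b j → i ≡ τ ⟨$⟩ʳ j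
  from e = FinP.punchIn-injective a i (τ ⟨$⟩ʳ j) (trans e (punchIn-permute σ b j))

SI-injective : ∀ {m n} {f : Fin m → Fin n} → StrictlyIncreasing f →
  ∀ {x y} → f x ≡ f y → x ≡ y
SI-injective si {x} {y} e with FinP.<-cmp x y
... | tri< x<y _ _ = ⊥-elim (ℕP.<-irrefl (cong toℕ e) (si x<y))
... | tri≈ _ x≡y _ = x≡y
... | tri> _ _ y<x = ⊥-elim (ℕP.<-irrefl (cong toℕ (sym e)) (si y<x))

SI-≤ : ∀ {m n} {f : Fin m → Fin n} → StrictlyIncreasing f → m ℕ.≤ n
SI-≤ {f = f} si = FinP.injective⇒≤ {f = f} (SI-injective si)

inject₁-SI : ∀ {n} → StrictlyIncreasing (inject₁ {n})
inject₁-SI {a = a} {b} lt =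
  subst₂ ℕ._<_ (sym (FinP.toℕ-inject₁ a)) (sym (FinP.toℕ-inject₁ b)) lt

fsuc-SI : ∀ {n} → StrictlyIncreasing (fsuc {n})
fsuc-SI lt = s≤s lt

SI-lower : ∀ {m n} {f : Fin m → Fin n} → StrictlyIncreasing f →
  ∀ x → toℕ x ℕ.≤ toℕ (f x)
SI-lower si fzero = z≤n
SI-lower {f = f} si (fsuc x) =
  ℕP.≤-<-trans (SI-lower {f = f ∘ inject₁} (si ∘ inject₁-SI) x)
               (si (FinP.≤̄⇒inject₁< ℕP.≤-refl))

SI-upper : ∀ {m n} {f : Fin m → Fin n} → StrictlyIncreasing f →
  ∀ x → toℕ (f x) + (m ∸ toℕ x) ℕ.≤ n
SI-upper {suc zero} {n} {f} si fzero =
  subst (ℕ._≤ n) (ℕP.+-comm 1 (toℕ (f fzero))) (FinP.toℕ<n (f fzero))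
SI-upper {suc (suc m)} {n} {f} si fzero = begin
  toℕ (f fzero) + suc (suc m)      ≡⟨ ℕP.+-suc (toℕ (f fzero)) (suc m) ⟩
  suc (toℕ (f fzero)) + suc m      ≤⟨ ℕP.+-monoˡ-≤ (suc m) (si {fzero} {fsuc fzero} (s≤s z≤n)) ⟩
  toℕ (f (fsuc fzero)) + suc m     ≤⟨ SI-upper {f = f ∘ fsuc} (si ∘ fsuc-SI) fzero ⟩
  n                                ∎
  where open ℕP.≤-Reasoning
SI-upper {suc m} {f = f} si (fsuc x) = SI-upper {f = f ∘ fsuc} (si ∘ fsuc-SI) x

SI-toℕ : ∀ {m n} {f : Fin m → Fin n} → StrictlyIncreasing f → n ℕ.≤ m →
  ∀ x → toℕ (f x) ≡ toℕ x
SI-toℕ {m} {n} {f} si n≤m x =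
  ℕP.≤-antisym (ℕP.+-cancelʳ-≤ (m ∸ toℕ x) (toℕ (f x)) (toℕ x) shifted) (SI-lower si x)
  where
  open ℕP.≤-Reasoning
  shifted : toℕ (f x) + (m ∸ toℕ x) ℕ.≤ toℕ x + (m ∸ toℕ x)
  shifted = begin
    toℕ (f x) + (m ∸ toℕ x)  ≤⟨ SI-upper si x ⟩
    n                        ≤⟨ n≤m ⟩
    m                        ≡⟨ sym (ℕP.m+[n∸m]≡n (ℕP.<⇒≤ (FinP.toℕ<n x))) ⟩
    toℕ x + (m ∸ toℕ x)      ∎

SI-section : ∀ {m n} {f : Fin m → Fin n} → StrictlyIncreasing f → n ℕ.≤ m →
  Σ (Fin n → Fin m) λ g → StrictlyIncreasing g × (∀ y → f (g y) ≡ y)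
SI-section {f = f} si n≤m = g , g-SI , fg≡id
  where
  bound : ∀ y → toℕ y ℕ.< _
  bound y = ℕP.≤-trans (FinP.toℕ<n y) n≤m
  g : Fin _ → Fin _
  g y = fromℕ< (bound y)
  g-SI : StrictlyIncreasing g
  g-SI {y} {z} lt =
    subst₂ ℕ._<_ (sym (FinP.toℕ-fromℕ< (bound y))) (sym (FinP.toℕ-fromℕ< (bound z))) lt
  fg≡id : ∀ y → f (g y) ≡ y
  fg≡id y = FinP.toℕ-injective (trans (SI-toℕ si n≤m (g y)) (FinP.toℕ-fromℕ< (bound y)))

punchIn-SI : ∀ {n} (a : Fin (suc n)) → StrictlyIncreasing (punchIn a)
punchIn-SI a {x} {y} lt =
  ℕP.≰⇒> (λ le → ℕP.<⇒≱ lt (FinP.punchIn-cancel-≤ a y x le))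

punchOut-SI : ∀ {k n} {a : Fin (suc n)} {f : Fin k → Fin (suc n)} →
  StrictlyIncreasing f → (avoid : ∀ i → a ≢ f i) →
  StrictlyIncreasing (λ i → punchOut (avoid i))
punchOut-SI si avoid {x} {y} lt =
  ℕP.≰⇒> (λ le → ℕP.<⇒≱ (si lt) (FinP.punchOut-cancel-≤ (avoid y) (avoid x) le))

≼-size : ∀ {m n} (τ : Permutation′ m) (σ : Permutation′ n) → τ ≼ σ → m ℕ.≤ n
≼-size _ _ (_ , _ , sr , _) = SI-≤ sr

Submatrix-reverse : ∀ {k′ ℓ′ k ℓ} {N : Matrix k′ ℓ′} {M : Matrix k ℓ} →
  Submatrix N M → k ℕ.≤ k′ → ℓ ℕ.≤ ℓ′ → Submatrix M N
Submatrix-reverse {M = M} (r , c , sr , sc , eq) k≤k′ ℓ≤ℓ′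
  with SI-section sr k≤k′ | SI-section sc ℓ≤ℓ′
... | r⁻ , sr⁻ , rr⁻ | c⁻ , sc⁻ , cc⁻ =
  r⁻ , c⁻ , sr⁻ , sc⁻ ,
  λ i j → sym (trans (eq (r⁻ i) (c⁻ j)) (cong₂ M (rr⁻ i) (cc⁻ j)))

transpose : ∀ {k ℓ} → Matrix k ℓ → Matrix ℓ k
transpose M j i = M i j

isZeroRow-sound : ∀ {k ℓ} (M : Matrix k ℓ) i → isZeroRow M i ≡ true → ZeroRow M i
isZeroRow-sound {ℓ = suc ℓ} M i h j with M i fzero in Mi0
isZeroRow-sound {ℓ = suc ℓ} M i () j | true
isZeroRow-sound {ℓ = suc ℓ} M i h fzero | false = Mi0
isZeroRow-sound {ℓ = suc ℓ} M i h (fsuc j) | false =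
  isZeroRow-sound (λ a b → M a (fsuc b)) i h j

isZeroRow-complete : ∀ {k ℓ} (M : Matrix k ℓ) i → ZeroRow M i → isZeroRow M i ≡ true
isZeroRow-complete {ℓ = zero} M i z = refl
isZeroRow-complete {ℓ = suc ℓ} M i z rewrite z fzero =
  isZeroRow-complete (λ a b → M a (fsuc b)) i (z ∘ fsuc)

record Enumeration (C : ℕ) {L : ℕ} (p : Fin L → Bool) : Set where
  field
    index     : Fin C → Fin L
    satisfies : ∀ t → p (index t) ≡ true
    distinct  : ∀ {s t} → index s ≡ index t → s ≡ t
    onto      : ∀ j → p j ≡ true → ∃ λ t → index t ≡ j

enumeration-keep : ∀ {C L} {p : Fin (suc L) → Bool} → p fzero ≡ true →
  Enumeration C (p ∘ fsuc) → Enumeration (suc C) p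
enumeration-keep {C} {L} {p} p0 E = record
  { index = index ; satisfies = satisfies ; distinct = distinct ; onto = onto }
  where
  module E = Enumeration E
  index : Fin (suc C) → Fin (suc L)
  index fzero = fzero
  index (fsuc t) = fsuc (E.index t)
  satisfies : ∀ t → p (index t) ≡ true
  satisfies fzero = p0
  satisfies (fsuc t) = E.satisfies t
  distinct : ∀ {s t} → index s ≡ index t → s ≡ t
  distinct {fzero} {fzero} _ = refl
  distinct {fsuc s} {fsuc t} e = cong fsuc (E.distinct (FinP.suc-injective e))
  onto : ∀ j → p j ≡ true → ∃ λ t → index t ≡ j
  onto fzero _ = fzero , refl
  onto (fsuc j) pj with E.onto j pj
  ... | t , e = fsuc t , cong fsuc e

enumeration-skip : ∀ {C L} {p : Fin (suc L) → Bool} → p fzero ≡ false →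
  Enumeration C (p ∘ fsuc) → Enumeration C p
enumeration-skip {C} {L} {p} p0 E = record
  { index = fsuc ∘ E.index ; satisfies = E.satisfies
  ; distinct = E.distinct ∘ FinP.suc-injective ; onto = onto }
  where
  module E = Enumeration E
  onto : ∀ j → p j ≡ true → ∃ λ t → fsuc (E.index t) ≡ j
  onto fzero pj = ⊥-elim (true≢false (trans (sym pj) p0))
  onto (fsuc j) pj with E.onto j pj
  ... | t , e = t , cong fsuc e

enumerate : ∀ {L} (p : Fin L → Bool) → Enumeration (count p) p
enumerate {zero} p = record
  { index = λ () ; satisfies = λ () ; distinct = λ { {()} } ; onto = λ () }
enumerate {suc L} p = byHead (p fzero) refl
  where
  byHead : ∀ b → p fzero ≡ b →
    Enumeration ((if b then 1 else 0) + count (p ∘ fsuc)) p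
  byHead true p0 = enumeration-keep p0 (enumerate (p ∘ fsuc))
  byHead false p0 = enumeration-skip p0 (enumerate (p ∘ fsuc))

module Counting {A N L : ℕ} (p : Fin L → Bool) (f : Fin A → Fin N) (g : Fin L → Fin N) where
  open Enumeration (enumerate p)

  combined : Fin A ⊎ Fin (count p) → Fin N
  combined = [ f , g ∘ index ]′

  splitAt-injective : ∀ {z z′} → splitAt A {count p} z ≡ splitAt A z′ → z ≡ z′
  splitAt-injective {z} {z′} e =
    trans (sym (FinP.join-splitAt A _ z)) (trans (cong (join A _) e) (FinP.join-splitAt A _ z′))

  count-lower : (∀ {x y} → f x ≡ f y → x ≡ y) →
    (∀ {j j′} → p j ≡ true → p j′ ≡ true → g j ≡ g j′ → j ≡ j′) →
    (∀ x j → p j ≡ true → f x ≢ g j) → A + count p ℕ.≤ N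
  count-lower f-inj g-inj disjoint =
    FinP.injective⇒≤ {f = combined ∘ splitAt A} (splitAt-injective ∘ combined-injective)
    where
    combined-injective : ∀ {u v} → combined u ≡ combined v → u ≡ v
    combined-injective {inj₁ x} {inj₁ y} e = cong inj₁ (f-inj e)
    combined-injective {inj₁ x} {inj₂ t} e = ⊥-elim (disjoint x (index t) (satisfies t) e)
    combined-injective {inj₂ s} {inj₁ y} e = ⊥-elim (disjoint y (index s) (satisfies s) (sym e))
    combined-injective {inj₂ s} {inj₂ t} e =
      cong inj₂ (distinct (g-inj (satisfies s) (satisfies t) e))

  count-upper : (∀ z → (∃ λ x → f x ≡ z) ⊎ (∃ λ j → p j ≡ true × g j ≡ z)) →
    N ℕ.≤ A + count p
  count-upper cover = FinP.injective⇒≤ {f = code} code-injective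
    where
    preimage : ∀ z → Σ (Fin A ⊎ Fin (count p)) λ u → combined u ≡ z
    preimage z with cover z
    ... | inj₁ (x , fx≡z) = inj₁ x , fx≡z
    ... | inj₂ (j , pj , gj≡z) with onto j pj
    ...   | t , index≡j = inj₂ t , trans (cong g index≡j) gj≡z
    code : Fin N → Fin (A + count p)
    code z = join A _ (proj₁ (preimage z))
    decode : ∀ z → combined (splitAt A (code z)) ≡ z
    decode z = trans (cong combined (FinP.splitAt-join A _ (proj₁ (preimage z)))) (proj₂ (preimage z))
    code-injective : ∀ {z z′} → code z ≡ code z′ → z ≡ z′
    code-injective {z} {z′} e =
      trans (sym (decode z)) (trans (cong (combined ∘ splitAt A) e) (decode z′))

open Counting using (count-lower; count-upper)

Obtained⇒Contains : ∀ {k ℓ n} {M : Matrix k ℓ} {σ : Permutation′ n} →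
  ObtainedByInsertion M (permMatrix σ) → Contains σ M
Obtained⇒Contains (r , c , sr , sc , eq , _) = r , c , sr , sc , eq

-- The rows used by M and the rows holding the 1 of a zero column of M are
-- pairwise distinct, so a permutation containing M has ≥ k + x rows.
rows-lower : ∀ {k ℓ m} (M : Matrix k ℓ) (τ : Permutation′ m) → Contains τ M →
  k + numZeroCols M ℕ.≤ m
rows-lower M τ (r , c , sr , sc , eq) =
  count-lower (isZeroCol M) r (λ j → τ ⟨$⟩ʳ c j) (SI-injective sr)
    (λ _ _ e → SI-injective sc (σ-injective τ e)) disjoint
  where
  disjoint : ∀ i j → isZeroCol M j ≡ true → r i ≢ τ ⟨$⟩ʳ c j
  disjoint i j zeroCol e = true≢false (begin
    true                      ≡⟨ sym (image⇒entry τ e) ⟩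
    permMatrix τ (r i) (c j)  ≡⟨ sym (eq i j) ⟩
    M i j                     ≡⟨ isZeroRow-sound (transpose M) j zeroCol i ⟩
    false                     ∎)
    where open ≡-Reasoning

-- After insertion these are all the rows.
rows-upper : ∀ {k ℓ n} (M : Matrix k ℓ) (σ : Permutation′ n) →
  ObtainedByInsertion M (permMatrix σ) → n ℕ.≤ k + numZeroCols M
rows-upper M σ (r , c , sr , sc , eq , insertedRow , _) =
  count-upper (isZeroCol M) r (λ j → σ ⟨$⟩ʳ c j) cover
  where
  cover : ∀ a → (∃ λ i → r i ≡ a) ⊎ (∃ λ j → isZeroCol M j ≡ true × σ ⟨$⟩ʳ c j ≡ a)
  cover a with FinP.any? (λ i → r i ≟ a)
  ... | yes used = inj₁ used
  ... | no unused with insertedRow a (λ i e → unused (i , e))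
  ...   | j , entry , zeroCol , _ =
    inj₂ (j , isZeroRow-complete (transpose M) j zeroCol , sym (entry⇒image σ entry))

rows-exact : ∀ {k ℓ n} (M : Matrix k ℓ) (σ : Permutation′ n) →
  ObtainedByInsertion M (permMatrix σ) → n ≡ k + numZeroCols M
rows-exact M σ ob = ℕP.≤-antisym (rows-upper M σ ob) (rows-lower M σ (Obtained⇒Contains {σ = σ} ob))

Obtained-flip : ∀ {k ℓ n} (M : Matrix k ℓ) (σ : Permutation′ n) →
  ObtainedByInsertion M (permMatrix σ) →
  ObtainedByInsertion (transpose M) (permMatrix (flip σ))
Obtained-flip M σ (r , c , sr , sc , eq , insertedRow , insertedCol) =
  c , r , sc , sr , (λ j i → trans (eq i j) (sym (permMatrix-flip σ (r i) (c j)))) ,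
  insertedRow′ , insertedCol′
  where
  flipped : ∀ {a b} → permMatrix σ a b ≡ true → permMatrix (flip σ) b a ≡ true
  flipped {a} {b} e = trans (permMatrix-flip σ a b) e
  unflipped : ∀ {a b} → permMatrix (flip σ) b a ≡ true → permMatrix σ a b ≡ true
  unflipped {a} {b} e = trans (sym (permMatrix-flip σ a b)) e
  insertedRow′ : ∀ b → (∀ j → ¬ (c j ≡ b)) → Σ (Fin _) λ i →
    permMatrix (flip σ) b (r i) ≡ true × ZeroCol (transpose M) i ×
    (∀ a → permMatrix (flip σ) b a ≡ true → a ≡ r i)
  insertedRow′ b b∉c with insertedCol b b∉c
  ... | i , entry , zeroRow , unique = i , flipped entry , zeroRow , λ a e → unique a (unflipped e)
  insertedCol′ : ∀ a → (∀ i → ¬ (r i ≡ a)) → Σ (Fin _) λ j →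
    permMatrix (flip σ) (c j) a ≡ true × ZeroRow (transpose M) j ×
    (∀ b → permMatrix (flip σ) b a ≡ true → b ≡ c j)
  insertedCol′ a a∉r with insertedRow a a∉r
  ... | j , entry , zeroCol , unique = j , flipped entry , zeroCol , λ b e → unique b (unflipped e)

cols-exact : ∀ {k ℓ n} (M : Matrix k ℓ) (σ : Permutation′ n) →
  ObtainedByInsertion M (permMatrix σ) → n ≡ ℓ + numZeroRows M
cols-exact M σ ob = rows-exact (transpose M) (flip σ) (Obtained-flip M σ ob)

Irreducible : ∀ {k ℓ n} → Matrix k ℓ → Permutation′ n → Set
Irreducible M σ = ∀ m (τ : Permutation′ m) → Contains τ M → τ ≼ σ → σ ≼ τ

remove-≼ : ∀ {n} (σ : Permutation′ (suc n)) b → remove b σ ≼ σ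
remove-≼ σ b =
  punchIn (σ ⟨$⟩ʳ b) , punchIn b , punchIn-SI (σ ⟨$⟩ʳ b) , punchIn-SI b , permMatrix-remove σ b

remove-Contains : ∀ {k ℓ n} {M : Matrix k ℓ} (σ : Permutation′ (suc n)) b →
  (emb : Contains σ M) →
  (∀ i → σ ⟨$⟩ʳ b ≢ proj₁ emb i) → (∀ j → b ≢ proj₁ (proj₂ emb) j) →
  Contains (remove b σ) M
remove-Contains {k} {ℓ} {n} {M} σ b (r , c , sr , sc , eq) row∉r b∉c =
  r′ , c′ , punchOut-SI sr row∉r , punchOut-SI sc b∉c , entries
  where
  r′ : Fin k → Fin n
  r′ i = punchOut (row∉r i)
  c′ : Fin ℓ → Fin n
  c′ j = punchOut (b∉c j)
  entries : ∀ i j → M i j ≡ permMatrix (remove b σ) (r′ i) (c′ j)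
  entries i j = begin
    M i j
      ≡⟨ eq i j ⟩
    permMatrix σ (r i) (c j)
      ≡⟨ cong₂ (permMatrix σ) (sym (FinP.punchIn-punchOut (row∉r i)))
                              (sym (FinP.punchIn-punchOut (b∉c j))) ⟩
    permMatrix σ (punchIn (σ ⟨$⟩ʳ b) (r′ i)) (punchIn b (c′ j))
      ≡⟨ sym (permMatrix-remove σ b (r′ i) (c′ j)) ⟩
    permMatrix (remove b σ) (r′ i) (c′ j)
      ∎
    where open ≡-Reasoning

no-free-crossing : ∀ {k ℓ n} {M : Matrix k ℓ} (σ : Permutation′ n) → Irreducible M σ →
  (emb : Contains σ M) → ∀ b →
  (∀ i → σ ⟨$⟩ʳ b ≢ proj₁ emb i) → (∀ j → b ≢ proj₁ (proj₂ emb) j) → ⊥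
no-free-crossing {n = zero} σ irr emb () row∉r b∉c
no-free-crossing {n = suc n} {M = M} σ irr emb b row∉r b∉c = ℕP.n≮n n (≼-size σ τ σ≼τ)
  where
  τ : Permutation′ n
  τ = remove b σ
  σ≼τ : σ ≼ τ
  σ≼τ = irr n τ (remove-Contains σ b emb row∉r b∉c) (remove-≼ σ b)

minimal⇒obtained : ∀ {k ℓ n} (M : Matrix k ℓ) (σ : Permutation′ n) →
  MinimalContaining M σ → ObtainedByInsertion M (permMatrix σ)
minimal⇒obtained {k} {ℓ} M σ (emb@(r , c , sr , sc , eq) , irr) =
  r , c , sr , sc , eq , insertedRow , insertedCol
  where
  insertedRow : ∀ a → (∀ i → ¬ (r i ≡ a)) → Σ (Fin ℓ) λ j →
    permMatrix σ a (c j) ≡ true × ZeroCol M j × (∀ b → permMatrix σ a b ≡ true → b ≡ c j)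
  insertedRow a a∉r with FinP.any? (λ j → c j ≟ σ ⟨$⟩ˡ a)
  ... | yes (j , cj≡b) = j , image⇒entry σ (sym σcj≡a) , zeroCol , unique
    where
    σcj≡a : σ ⟨$⟩ʳ c j ≡ a
    σcj≡a = trans (cong (σ ⟨$⟩ʳ_) cj≡b) (inverseʳ σ)
    zeroCol : ZeroCol M j
    zeroCol i = ¬-not λ Mij →
      a∉r i (trans (entry⇒image σ (trans (sym (eq i j)) Mij)) σcj≡a)
    unique : ∀ b → permMatrix σ a b ≡ true → b ≡ c j
    unique b e = σ-injective σ (trans (sym (entry⇒image σ e)) (sym σcj≡a))
  ... | no b∉c = ⊥-elim (no-free-crossing σ irr emb (σ ⟨$⟩ˡ a)
          (λ i e → a∉r i (trans (sym e) (inverseʳ σ))) (λ j e → b∉c (j , sym e)))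
  insertedCol : ∀ b → (∀ j → ¬ (c j ≡ b)) → Σ (Fin k) λ i →
    permMatrix σ (r i) b ≡ true × ZeroRow M i × (∀ a → permMatrix σ a b ≡ true → a ≡ r i)
  insertedCol b b∉c with FinP.any? (λ i → r i ≟ σ ⟨$⟩ʳ b)
  ... | yes (i , ri≡σb) = i , image⇒entry σ ri≡σb , zeroRow , unique
    where
    zeroRow : ZeroRow M i
    zeroRow j = ¬-not λ Mij →
      b∉c j (σ-injective σ (trans (sym (entry⇒image σ (trans (sym (eq i j)) Mij))) ri≡σb))
    unique : ∀ a → permMatrix σ a b ≡ true → a ≡ r i
    unique a e = trans (entry⇒image σ e) (sym ri≡σb)
  ... | no a∉r = ⊥-elim (no-free-crossing σ irr emb b
          (λ i e → a∉r (i , sym e)) (λ j e → b∉c j (sym e)))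

-- A permutation obtained by insertion has the least possible size among
-- permutations containing M, so σ occurs in each of its patterns containing M.
obtained⇒minimal : ∀ {k ℓ n} (M : Matrix k ℓ) (σ : Permutation′ n) →
  ObtainedByInsertion M (permMatrix σ) → MinimalContaining M σ
obtained⇒minimal {n = n} M σ ob = Obtained⇒Contains {σ = σ} ob , irreducible
  where
  irreducible : Irreducible M σ
  irreducible m τ τ-contains τ≼σ = Submatrix-reverse τ≼σ n≤m n≤m
    where
    n≤m : n ℕ.≤ m
    n≤m = ℕP.≤-trans (ℕP.≤-reflexive (rows-exact M σ ob)) (rows-lower M τ τ-contains)

mainTheorem10 : (k ℓ : ℕ) (M : Matrix k ℓ) → QuasiPermutation M →
  ((n : ℕ) (σ : Permutation′ n) →
    MinimalContaining M σ ⇔ ObtainedByInsertion M (permMatrix σ)) ×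
  ((n : ℕ) (σ : Permutation′ n) → MinimalContaining M σ →
    (n ≡ k + numZeroCols M) × (n ≡ ℓ + numZeroRows M))
mainTheorem10 k ℓ M _ = characterisation , sizes
  where
  characterisation : (n : ℕ) (σ : Permutation′ n) →
    MinimalContaining M σ ⇔ ObtainedByInsertion M (permMatrix σ)
  characterisation n σ = mk⇔ (minimal⇒obtained M σ) (obtained⇒minimal M σ)
  sizes : (n : ℕ) (σ : Permutation′ n) → MinimalContaining M σ →
    (n ≡ k + numZeroCols M) × (n ≡ ℓ + numZeroRows M)
  sizes n σ minimal = rows-exact M σ obtained , cols-exact M σ obtained
    where
    obtained : ObtainedByInsertion M (permMatrix σ)
    obtained = minimal⇒obtained M σ minimal
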